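{- Let $n$ and $m$ be positive integers with $m\geq n+1$, and let $P=(x_1,y_1)\cdots(x_{n+1},y_{n+1})$ be an $(n,m)$-lattice path. Then $|\mathcal{PL}(P)|=m$.
   Context: An $(n,m)$-lattice path is a sequence $P=(x_1,y_1)(x_2,y_2)\cdots(x_{n+1},y_{n+1})$ of vectors in $\mathbb{Z}^2$ such that $1-n\leq y_i\leq 1$ for all $i$, $\sum_{i=1}^{n+1}y_i=1$, $1\leq x_i\leq m-1$ for all $i$, and $\sum_{i=1}^{n+1}x_i=m$. A pointed $(n,m)$-lattice path is a pair $[Q;j]$ where $Q=(u_1,v_1)\cdots(u_{n+1},v_{n+1})$ is an $(n,m)$-lattice path and $0\leq j\leq u_{n+1}-1$. For $i\in\{1,\ldots,n+1\}$, the $i$th cyclic permutation of $P$ is $P_i=(x_{i+1},y_{i+1})\cdots(x_{n+1},y_{n+1})(x_1,y_1)\cdots(x_i,y_i)$ (so $P_{n+1}=P$); it is again an $(n,m)$-lattice path whose last step is $(x_i,y_i)$. Define $\mathcal{PL}(P)=\{[P_i;j]\mid i\in\{1,\ldots,n+1\},\ 0\leq j\leq x_i-1\}$. -}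

module Defs where

open import Data.Nat using (ℕ; zero; suc)
open import Data.Integer using (ℤ; +_; _+_; _-_; _≤_; ∣_∣)
open import Data.Integer.Properties using () renaming (_≟_ to _≟ℤ_)
open import Data.Nat.Properties using () renaming (_≟_ to _≟ℕ_)
open import Data.Product using (_×_; _,_; proj₁; proj₂)
open import Data.Product.Properties using (≡-dec)
open import Data.Vec using (Vec; []; _∷_; _∷ʳ_; foldr; last)
open import Data.Vec.Relation.Unary.All using (All)
import Data.Vec.Properties as VP
open import Data.List using (List; map; upTo; concatMap; deduplicate; length)
open import Relation.Binary.Definitions using (DecidableEquality)
open import Relation.Binary.PropositionalEquality using (_≡_)
open import Function using (_∘_)

Step : Set
Step = ℤ × ℤ

Seq : ℕ → Set
Seq n = Vec Step (suc n)

sumℤ : ∀ {k} → Vec ℤ k → ℤ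
sumℤ = foldr _ _+_ (+ 0)

xs : ∀ {k} → Vec Step k → Vec ℤ k
xs = Data.Vec.map proj₁

ys : ∀ {k} → Vec Step k → Vec ℤ k
ys = Data.Vec.map proj₂

IsLatticePath : (n m : ℕ) → Seq n → Set
IsLatticePath n m P =
  All (λ y → ((+ 1) - (+ n) ≤ y) × (y ≤ + 1)) (ys P) ×
  (sumℤ (ys P) ≡ + 1) ×
  All (λ x → (+ 1 ≤ x) × (x ≤ (+ m) - (+ 1))) (xs P) ×
  (sumℤ (xs P) ≡ + m)

rot1 : ∀ {n} → Seq n → Seq n
rot1 (s ∷ ss) = ss ∷ʳ s

-- i-th cyclic permutation P_i = (x_{i+1},y_{i+1})⋯(x_{n+1},y_{n+1})(x_1,y_1)⋯(x_i,y_i)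
cyc : ∀ {n} → ℕ → Seq n → Seq n
cyc zero    P = P
cyc (suc i) P = cyc i (rot1 P)

Pointed : ℕ → Set
Pointed n = Seq n × ℕ

_≟Step_ : DecidableEquality Step
_≟Step_ = ≡-dec _≟ℤ_ _≟ℤ_

_≟Pointed_ : ∀ {n} → DecidableEquality (Pointed n)
_≟Pointed_ = ≡-dec (VP.≡-dec _≟Step_) _≟ℕ_

-- PL(P) as a list (possibly with repetitions):
-- [P_i ; j] for i ∈ {1,…,n+1}, 0 ≤ j ≤ x_i - 1, where (x_i,y_i) is the last step of P_i
PLList : ∀ {n} → Seq n → List (Pointed n)
PLList {n} P =
  concatMap (λ i → map (λ j → (cyc i P , j)) (upTo ∣ proj₁ (last (cyc i P)) ∣))
            (map suc (upTo (suc n)))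

cardPL : ∀ {n} → Seq n → ℕ
cardPL P = length (deduplicate _≟Pointed_ (PLList P))

-- The n+1 cyclic permutations of P are pairwise distinct: a rotation by 0 < d < n+1 fixing the
-- y-sequence would make it both d- and (n+1)-periodic, and summing its first d(n+1) terms in two
-- ways gives d · 1 = (n+1) · c, impossible for 0 < d < n+1.  Hence PL(P) has no repetitions, and
-- since the last steps of P_1, …, P_{n+1} are the steps of P, |PL(P)| = x_1 + ⋯ + x_{n+1} = m.
module Submission where

open import Defs
open import Data.Nat using (ℕ; _≤_; _+_)
open import Relation.Binary.PropositionalEquality using (_≡_)

open import Data.Nat using (zero; suc; _<_; _*_; _∸_; z≤n; s≤s; >-nonZero)
import Data.Nat.Properties as ℕP
open import Data.Nat.Divisibility using (_∣_; divides; ∣⇒≤)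
open import Data.Nat.ListAction using (sum)
open import Data.Integer using (ℤ; +_; ∣_∣; +≤+)
  renaming (_+_ to _+ℤ_; _*_ to _*ℤ_; _≤_ to _≤ℤ_)
import Data.Integer.Properties as ℤP
open import Data.Product using (_×_; _,_; proj₁; proj₂)
open import Data.Vec as Vec using (Vec; _∷_; _∷ʳ_; last; toList)
import Data.Vec.Properties as VecP
import Data.Vec.Relation.Unary.All as VecAll
import Data.Vec.Relation.Unary.All.Properties as VecAllP
open import Data.List as List
  using (List; []; _∷_; _++_; [_]; map; concat; concatMap; applyUpTo; upTo; length; deduplicate)
import Data.List.Properties as ListP
open import Data.List.Relation.Unary.All as All using (All; []; _∷_)
import Data.List.Relation.Unary.All.Properties as AllP
import Data.List.Relation.Unary.AllPairs as AllPairs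
import Data.List.Relation.Unary.AllPairs.Properties as AllPairsP
open import Data.List.Relation.Binary.Disjoint.Propositional using (Disjoint)
open import Data.List.Relation.Unary.Unique.Propositional using (Unique; []; _∷_)
import Data.List.Relation.Unary.Unique.Propositional.Properties as UniqueP
open import Data.List.Membership.Propositional.Properties using (∈-map⁻)
open import Relation.Binary.PropositionalEquality
  using (refl; sym; trans; cong; cong₂; subst; _≢_; module ≡-Reasoning)
open import Relation.Binary.Definitions using (DecidableEquality)
open import Relation.Nullary using (¬?)
open import Function using (_∘_)

private
  variable
    A K : Set

open ≡-Reasoning

∑ : List ℤ → ℤ
∑ = List.foldr _+ℤ_ (+ 0)

∑-++ : ∀ as bs → ∑ (as ++ bs) ≡ ∑ as +ℤ ∑ bs
∑-++ []       bs = sym (ℤP.+-identityˡ (∑ bs))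
∑-++ (a ∷ as) bs = trans (cong (a +ℤ_) (∑-++ as bs)) (sym (ℤP.+-assoc a (∑ as) (∑ bs)))

sumℤ-toList : ∀ {k} (v : Vec ℤ k) → sumℤ v ≡ ∑ (toList v)
sumℤ-toList Vec.[]  = refl
sumℤ-toList (z ∷ v) = cong (z +ℤ_) (sumℤ-toList v)

pos-sum-map-∣∣ : ∀ {zs} → All (+ 0 ≤ℤ_) zs → + sum (map ∣_∣ zs) ≡ ∑ zs
pos-sum-map-∣∣ []                     = refl
pos-sum-map-∣∣ {z ∷ zs} (z≥0 ∷ zs≥0) = begin
  + (∣ z ∣ + sum (map ∣_∣ zs))     ≡⟨ ℤP.pos-+ ∣ z ∣ _ ⟩
  + ∣ z ∣ +ℤ + sum (map ∣_∣ zs)   ≡⟨ cong (_+ℤ + sum (map ∣_∣ zs)) (ℤP.0≤i⇒+∣i∣≡i z≥0) ⟩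
  z +ℤ + sum (map ∣_∣ zs)         ≡⟨ cong (z +ℤ_) (pos-sum-map-∣∣ zs≥0) ⟩
  z +ℤ ∑ zs                       ∎

applyUpTo-cong : ∀ {f g : ℕ → A} → (∀ t → f t ≡ g t) → ∀ n → applyUpTo f n ≡ applyUpTo g n
applyUpTo-cong f≗g zero    = refl
applyUpTo-cong f≗g (suc n) = cong₂ _∷_ (f≗g 0) (applyUpTo-cong (f≗g ∘ suc) n)

applyUpTo-+ : ∀ (f : ℕ → A) a b → applyUpTo f (a + b) ≡ applyUpTo f a ++ applyUpTo (λ t → f (a + t)) b
applyUpTo-+ f zero    b = refl
applyUpTo-+ f (suc a) b = cong (f 0 ∷_) (applyUpTo-+ (f ∘ suc) a b)

∑-applyUpTo-periodic : ∀ (f : ℕ → ℤ) p → (∀ t → f (p + t) ≡ f t) →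
                       ∀ k → ∑ (applyUpTo f (k * p)) ≡ + k *ℤ ∑ (applyUpTo f p)
∑-applyUpTo-periodic f p f-per zero    = refl
∑-applyUpTo-periodic f p f-per (suc k) = begin
  ∑ (applyUpTo f (p + k * p))                               ≡⟨ cong ∑ (applyUpTo-+ f p (k * p)) ⟩
  ∑ (applyUpTo f p ++ applyUpTo (λ t → f (p + t)) (k * p))  ≡⟨ ∑-++ (applyUpTo f p) _ ⟩
  S +ℤ ∑ (applyUpTo (λ t → f (p + t)) (k * p))              ≡⟨ cong (λ l → S +ℤ ∑ l) (applyUpTo-cong f-per (k * p)) ⟩
  S +ℤ ∑ (applyUpTo f (k * p))                              ≡⟨ cong (S +ℤ_) (∑-applyUpTo-periodic f p f-per k) ⟩
  S +ℤ + k *ℤ S                                             ≡⟨ ℤP.suc-* (+ k) S ⟨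
  + suc k *ℤ S                                              ∎
  where S = ∑ (applyUpTo f p)

rotate : List A → List A
rotate []       = []
rotate (x ∷ xs) = xs ++ [ x ]

rotate^ : ℕ → List A → List A
rotate^ zero    l = l
rotate^ (suc t) l = rotate^ t (rotate l)

rotate^-+ : ∀ a b (l : List A) → rotate^ (a + b) l ≡ rotate^ b (rotate^ a l)
rotate^-+ zero    b l = refl
rotate^-+ (suc a) b l = rotate^-+ a b (rotate l)

rotate^-++ : ∀ (as bs : List A) → rotate^ (length as) (as ++ bs) ≡ bs ++ as
rotate^-++ []       bs = sym (ListP.++-identityʳ bs)
rotate^-++ (a ∷ as) bs = begin
  rotate^ (length as) ((as ++ bs) ++ [ a ])   ≡⟨ cong (rotate^ (length as)) (ListP.++-assoc as bs [ a ]) ⟩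
  rotate^ (length as) (as ++ bs ++ [ a ])     ≡⟨ rotate^-++ as (bs ++ [ a ]) ⟩
  (bs ++ [ a ]) ++ as                         ≡⟨ ListP.++-assoc bs [ a ] as ⟩
  bs ++ a ∷ as                                ∎

rotate^-length : ∀ (l : List A) → rotate^ (length l) l ≡ l
rotate^-length l = begin
  rotate^ (length l) l          ≡⟨ cong (rotate^ (length l)) (sym (ListP.++-identityʳ l)) ⟩
  rotate^ (length l) (l ++ [])  ≡⟨ rotate^-++ l [] ⟩
  l                             ∎

rotate^-periodic : ∀ (l : List A) p → rotate^ p l ≡ l → ∀ t → rotate^ (p + t) l ≡ rotate^ t l
rotate^-periodic l p fixed t = trans (rotate^-+ p t l) (cong (rotate^ t) fixed)

map-rotate^ : ∀ {B : Set} (f : A → B) t l → map f (rotate^ t l) ≡ rotate^ t (map f l)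
map-rotate^ f zero    l        = refl
map-rotate^ f (suc t) []       = map-rotate^ f t []
map-rotate^ f (suc t) (x ∷ xs) = begin
  map f (rotate^ t (xs ++ [ x ]))   ≡⟨ map-rotate^ f t (xs ++ [ x ]) ⟩
  rotate^ t (map f (xs ++ [ x ]))   ≡⟨ cong (rotate^ t) (ListP.map-++ f xs [ x ]) ⟩
  rotate^ t (map f xs ++ [ f x ])   ∎

length-rotate^ : ∀ t (l : List A) → length (rotate^ t l) ≡ length l
length-rotate^ zero    l        = refl
length-rotate^ (suc t) []       = length-rotate^ t []
length-rotate^ (suc t) (x ∷ xs) = begin
  length (rotate^ t (xs ++ [ x ]))   ≡⟨ length-rotate^ t (xs ++ [ x ]) ⟩
  length (xs ++ [ x ])               ≡⟨ ListP.length-++ xs ⟩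
  length xs + 1                      ≡⟨ ℕP.+-comm (length xs) 1 ⟩
  suc (length xs)                    ∎

∑-rotate^ : ∀ t l → ∑ (rotate^ t l) ≡ ∑ l
∑-rotate^ zero    l        = refl
∑-rotate^ (suc t) []       = ∑-rotate^ t []
∑-rotate^ (suc t) (x ∷ xs) = begin
  ∑ (rotate^ t (xs ++ [ x ]))   ≡⟨ ∑-rotate^ t (xs ++ [ x ]) ⟩
  ∑ (xs ++ [ x ])               ≡⟨ ∑-++ xs [ x ] ⟩
  ∑ xs +ℤ (x +ℤ + 0)            ≡⟨ cong (∑ xs +ℤ_) (ℤP.+-identityʳ x) ⟩
  ∑ xs +ℤ x                     ≡⟨ ℤP.+-comm (∑ xs) x ⟩
  x +ℤ ∑ xs                     ∎

headOr : A → List A → A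
headOr d []      = d
headOr _ (x ∷ _) = x

applyUpTo-headOr-rotate^ : ∀ (d : A) l → applyUpTo (λ t → headOr d (rotate^ t l)) (length l) ≡ l
applyUpTo-headOr-rotate^ d l = begin
  applyUpTo (λ t → headOr d (rotate^ t l)) (length l)
    ≡⟨ applyUpTo-cong (λ t → cong (headOr d ∘ rotate^ t) (ListP.++-identityʳ l)) (length l) ⟨
  applyUpTo (λ t → headOr d (rotate^ t (l ++ []))) (length l)
    ≡⟨ heads l [] ⟩
  l ∎
  where
  heads : ∀ as bs → applyUpTo (λ t → headOr d (rotate^ t (as ++ bs))) (length as) ≡ as
  heads []       bs = refl
  heads (a ∷ as) bs = cong (a ∷_) (begin
    applyUpTo (λ t → headOr d (rotate^ t ((as ++ bs) ++ [ a ]))) (length as)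
      ≡⟨ applyUpTo-cong (λ t → cong (headOr d ∘ rotate^ t) (ListP.++-assoc as bs [ a ])) (length as) ⟩
    applyUpTo (λ t → headOr d (rotate^ t (as ++ bs ++ [ a ]))) (length as)
      ≡⟨ heads as (bs ++ [ a ]) ⟩
    as ∎)

rotate^-aperiodic : ∀ l → ∑ l ≡ + 1 → ∀ {d} → 0 < d → d < length l → rotate^ d l ≢ l
rotate^-aperiodic l ∑l≡1 {d} 0<d d<N fixed = ℕP.<⇒≱ d<N (∣⇒≤ {{>-nonZero 0<d}} N∣d)
  where
  N = length l

  s : ℕ → ℤ
  s t = headOr (+ 0) (rotate^ t l)

  s-periodic : ∀ p → rotate^ p l ≡ l → ∀ t → s (p + t) ≡ s t
  s-periodic p fixed t = cong (headOr (+ 0)) (rotate^-periodic l p fixed t)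

  d≡N*c : + d ≡ + N *ℤ ∑ (applyUpTo s d)
  d≡N*c = begin
    + d                        ≡⟨ sym (ℤP.*-identityʳ (+ d)) ⟩
    + d *ℤ + 1                 ≡⟨ cong (+ d *ℤ_) (sym ∑l≡1) ⟩
    + d *ℤ ∑ l                 ≡⟨ cong (λ l′ → + d *ℤ ∑ l′) (sym (applyUpTo-headOr-rotate^ (+ 0) l)) ⟩
    + d *ℤ ∑ (applyUpTo s N)   ≡⟨ sym (∑-applyUpTo-periodic s N (s-periodic N (rotate^-length l)) d) ⟩
    ∑ (applyUpTo s (d * N))    ≡⟨ cong (∑ ∘ applyUpTo s) (ℕP.*-comm d N) ⟩
    ∑ (applyUpTo s (N * d))    ≡⟨ ∑-applyUpTo-periodic s d (s-periodic d fixed) N ⟩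
    + N *ℤ ∑ (applyUpTo s d)   ∎

  N∣d : N ∣ d
  N∣d = divides ∣ ∑ (applyUpTo s d) ∣ (begin
    d                              ≡⟨ cong ∣_∣ d≡N*c ⟩
    ∣ + N *ℤ ∑ (applyUpTo s d) ∣   ≡⟨ ℤP.abs-* (+ N) _ ⟩
    N * ∣ ∑ (applyUpTo s d) ∣      ≡⟨ ℕP.*-comm N _ ⟩
    ∣ ∑ (applyUpTo s d) ∣ * N      ∎)

rotate^-injective : ∀ l → ∑ l ≡ + 1 → ∀ {i j} → i < j → j ∸ i < length l → rotate^ i l ≢ rotate^ j l
rotate^-injective l ∑l≡1 {i} {j} i<j j∸i<N eq =
  rotate^-aperiodic (rotate^ i l) (trans (∑-rotate^ i l) ∑l≡1) (ℕP.m<n⇒0<n∸m i<j)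
    (subst (j ∸ i <_) (sym (length-rotate^ i l)) j∸i<N) (begin
      rotate^ (j ∸ i) (rotate^ i l)   ≡⟨ sym (rotate^-+ i (j ∸ i) l) ⟩
      rotate^ (i + (j ∸ i)) l         ≡⟨ cong (λ k → rotate^ k l) (ℕP.m+[n∸m]≡n (ℕP.<⇒≤ i<j)) ⟩
      rotate^ j l                     ≡⟨ sym eq ⟩
      rotate^ i l                     ∎)

deduplicate-unique : (_≟_ : DecidableEquality A) → ∀ {xs} → Unique xs → deduplicate _≟_ xs ≡ xs
deduplicate-unique _≟_ []                      = refl
deduplicate-unique _≟_ {x ∷ xs} (x∉xs ∷ xs!) = cong (x ∷_) (begin
  List.filter (λ y → ¬? (x ≟ y)) (deduplicate _≟_ xs)   ≡⟨ cong (List.filter _) (deduplicate-unique _≟_ xs!) ⟩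
  List.filter (λ y → ¬? (x ≟ y)) xs                      ≡⟨ ListP.filter-all (λ y → ¬? (x ≟ y)) x∉xs ⟩
  xs                                                      ∎)

tagged : (K → ℕ) → K → List (K × ℕ)
tagged f k = map (k ,_) (upTo (f k))

Unique-concatMap-tagged : ∀ (f : K → ℕ) {ks} → Unique ks → Unique (concatMap (tagged f) ks)
Unique-concatMap-tagged f {ks} ks! = UniqueP.concat⁺
  (AllP.map⁺ (All.universal (λ k → UniqueP.map⁺ (cong proj₂) (UniqueP.upTo⁺ (f k))) ks))
  (AllPairsP.map⁺ (AllPairs.map disjoint ks!))
  where
  disjoint : ∀ {k k′} → k ≢ k′ → Disjoint (tagged f k) (tagged f k′)
  disjoint k≢k′ (v∈k , v∈k′) with ∈-map⁻ _ v∈k | ∈-map⁻ _ v∈k′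
  ... | _ , _ , refl | _ , _ , refl = k≢k′ refl

length-concatMap-tagged : ∀ (f : K → ℕ) ks → length (concatMap (tagged f) ks) ≡ sum (map f ks)
length-concatMap-tagged f []       = refl
length-concatMap-tagged f (k ∷ ks) = begin
  length (tagged f k ++ concatMap (tagged f) ks)         ≡⟨ ListP.length-++ (tagged f k) ⟩
  length (tagged f k) + length (concatMap (tagged f) ks) ≡⟨ cong₂ _+_ length-tagged (length-concatMap-tagged f ks) ⟩
  f k + sum (map f ks)                                   ∎
  where
  length-tagged : length (tagged f k) ≡ f k
  length-tagged = trans (ListP.length-map (k ,_) (upTo (f k))) (ListP.length-upTo (f k))

toList-cyc : ∀ {n} t (P : Seq n) → toList (cyc t P) ≡ rotate^ t (toList P)
toList-cyc zero    P        = refl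
toList-cyc (suc t) (s ∷ ss) = trans (toList-cyc t (ss ∷ʳ s)) (cong (rotate^ t) (VecP.toList-∷ʳ s ss))

toList-ys-cyc : ∀ {n} t (P : Seq n) → toList (ys (cyc t P)) ≡ rotate^ t (toList (ys P))
toList-ys-cyc t P = begin
  toList (ys (cyc t P))                 ≡⟨ VecP.toList-map proj₂ (cyc t P) ⟩
  map proj₂ (toList (cyc t P))          ≡⟨ cong (map proj₂) (toList-cyc t P) ⟩
  map proj₂ (rotate^ t (toList P))      ≡⟨ map-rotate^ proj₂ t (toList P) ⟩
  rotate^ t (map proj₂ (toList P))      ≡⟨ cong (rotate^ t) (VecP.toList-map proj₂ P) ⟨
  rotate^ t (toList (ys P))             ∎

last-cyc-suc : ∀ {n} i (P : Seq n) → last (cyc (suc i) P) ≡ headOr (Vec.head P) (rotate^ i (toList P))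
last-cyc-suc i P = begin
  last (cyc (suc i) P)                     ≡⟨ cong last (cyc-suc i P) ⟩
  last (rot1 (cyc i P))                    ≡⟨ last-rot1 (cyc i P) ⟩
  headOr (Vec.head P) (toList (cyc i P))   ≡⟨ cong (headOr (Vec.head P)) (toList-cyc i P) ⟩
  headOr (Vec.head P) (rotate^ i (toList P)) ∎
  where
  cyc-suc : ∀ {n} i (Q : Seq n) → cyc (suc i) Q ≡ rot1 (cyc i Q)
  cyc-suc zero    Q = refl
  cyc-suc (suc i) Q = cyc-suc i (rot1 Q)

  last-rot1 : ∀ {n} (Q : Seq n) → last (rot1 Q) ≡ headOr (Vec.head P) (toList Q)
  last-rot1 (s ∷ ss) = VecP.last-∷ʳ s ss

cycles : ∀ {n} → Seq n → List (Seq n)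
cycles {n} P = applyUpTo (λ i → cyc (suc i) P) (suc n)

cycles-unique : ∀ {n} (P : Seq n) → sumℤ (ys P) ≡ + 1 → Unique (cycles P)
cycles-unique {n} P Σy≡1 = UniqueP.applyUpTo⁺₁ _ (suc n) distinct
  where
  ys′ = toList (ys P)

  distinct : ∀ {i j} → i < j → j < suc n → cyc (suc i) P ≢ cyc (suc j) P
  distinct {i} {j} i<j j<1+n eq =
    rotate^-injective ys′ (trans (sym (sumℤ-toList (ys P))) Σy≡1) (s≤s i<j)
      (ℕP.≤-<-trans (ℕP.m∸n≤m j i) (subst (j <_) (sym (VecP.length-toList (ys P))) j<1+n)) (begin
        rotate^ (suc i) ys′           ≡⟨ toList-ys-cyc (suc i) P ⟨
        toList (ys (cyc (suc i) P))   ≡⟨ cong (toList ∘ ys) eq ⟩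
        toList (ys (cyc (suc j) P))   ≡⟨ toList-ys-cyc (suc j) P ⟩
        rotate^ (suc j) ys′           ∎)

map-last-cycles : ∀ {n} (P : Seq n) → map last (cycles P) ≡ toList P
map-last-cycles {n} P = begin
  map last (cycles P)                                    ≡⟨ ListP.map-applyUpTo (λ i → cyc (suc i) P) last (suc n) ⟩
  applyUpTo (λ i → last (cyc (suc i) P)) (suc n)         ≡⟨ applyUpTo-cong (λ i → last-cyc-suc i P) (suc n) ⟩
  applyUpTo (λ i → headOr d (rotate^ i l)) (suc n)       ≡⟨ cong (applyUpTo _) (VecP.length-toList P) ⟨
  applyUpTo (λ i → headOr d (rotate^ i l)) (length l)    ≡⟨ applyUpTo-headOr-rotate^ d l ⟩
  l                                                      ∎
  where
  l = toList P
  d = Vec.head P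

lastX : ∀ {n} → Seq n → ℕ
lastX Q = ∣ proj₁ (last Q) ∣

PLList-cycles : ∀ {n} (P : Seq n) → PLList P ≡ concatMap (tagged lastX) (cycles P)
PLList-cycles {n} P = cong concat (begin
  map F (map suc (upTo (suc n)))            ≡⟨ cong (map F) (ListP.map-upTo suc (suc n)) ⟩
  map F (applyUpTo suc (suc n))             ≡⟨ ListP.map-applyUpTo suc F (suc n) ⟩
  applyUpTo (F ∘ suc) (suc n)               ≡⟨ ListP.map-applyUpTo (λ i → cyc (suc i) P) (tagged lastX) (suc n) ⟨
  map (tagged lastX) (cycles P)             ∎)
  where
  F : ℕ → List (Pointed _)
  F i = tagged lastX (cyc i P)

sum-lastX-cycles : ∀ {n} (P : Seq n) → VecAll.All (+ 0 ≤ℤ_) (xs P) →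
                   sum (map lastX (cycles P)) ≡ ∣ sumℤ (xs P) ∣
sum-lastX-cycles P x≥0 = begin
  sum (map lastX (cycles P))                     ≡⟨ cong sum (ListP.map-∘ (cycles P)) ⟩
  sum (map (∣_∣ ∘ proj₁) (map last (cycles P)))  ≡⟨ cong (sum ∘ map (∣_∣ ∘ proj₁)) (map-last-cycles P) ⟩
  sum (map (∣_∣ ∘ proj₁) (toList P))             ≡⟨ cong sum (ListP.map-∘ (toList P)) ⟩
  sum (map ∣_∣ (map proj₁ (toList P)))           ≡⟨ cong (sum ∘ map ∣_∣) (VecP.toList-map proj₁ P) ⟨
  sum (map ∣_∣ (toList (xs P)))                  ≡⟨ cong ∣_∣ (pos-sum-map-∣∣ (VecAllP.toList⁺ x≥0)) ⟩
  ∣ ∑ (toList (xs P)) ∣                          ≡⟨ cong ∣_∣ (sumℤ-toList (xs P)) ⟨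
  ∣ sumℤ (xs P) ∣                                ∎

lemma3p4 : (n m : ℕ) → 1 ≤ n → 1 ≤ m → n + 1 ≤ m →
    (P : Seq n) → IsLatticePath n m P → cardPL P ≡ m
lemma3p4 n m _ _ _ P (_ , Σy≡1 , x-bounds , Σx≡m) = begin
  cardPL P                                                               ≡⟨ cong (length ∘ deduplicate _≟Pointed_) (PLList-cycles P) ⟩
  length (deduplicate _≟Pointed_ (concatMap (tagged lastX) (cycles P)))  ≡⟨ cong length (deduplicate-unique _≟Pointed_ PL-unique) ⟩
  length (concatMap (tagged lastX) (cycles P))                           ≡⟨ length-concatMap-tagged lastX (cycles P) ⟩
  sum (map lastX (cycles P))                                             ≡⟨ sum-lastX-cycles P x≥0 ⟩
  ∣ sumℤ (xs P) ∣                                                        ≡⟨ cong ∣_∣ Σx≡m ⟩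
  m                                                                      ∎
  where
  PL-unique : Unique (concatMap (tagged lastX) (cycles P))
  PL-unique = Unique-concatMap-tagged lastX (cycles-unique P Σy≡1)

  x≥0 : VecAll.All (+ 0 ≤ℤ_) (xs P)
  x≥0 = VecAll.map (λ (1≤x , _) → ℤP.≤-trans (+≤+ z≤n) 1≤x) x-bounds
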